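{- Let $n$ denote the number of vertices of the graph in question. (1) For $P(m,p,q)$ (of order $n=m+p+q-1$): $\alpha(P(m,p,q))=\lceil n/2\rceil-1$ if exactly two of $m,p,q$ are odd, and $\alpha(P(m,p,q))=\lceil n/2\rceil$ otherwise. (2) For $C(m,q)$ (of order $n=m+q-1$): $\alpha(C(m,q))=\lceil n/2\rceil-1$ if both $m,q$ are odd, and $\alpha(C(m,q))=\lceil n/2\rceil$ otherwise. (3) For $B(m,p,q)$ (of order $n=m+p+q-1$): $\alpha(B(m,p,q))=\lceil n/2\rceil-1$ if at least two of $m,p,q$ are odd, and $\alpha(B(m,p,q))=\lceil n/2\rceil$ otherwise.
   Context: $\alpha(G)$ is the independence number (maximum size of a set of pairwise non-adjacent vertices). For positive integers $m,p,q$ with at most one of them equal to $1$, $P(m,p,q)$ is the graph obtained from three paths with $m$, $p$, $q$ edges respectively by identifying one end vertex of each of the three paths into a single vertex and the other end vertices into a single second vertex. For $m,q\ge 3$, $C(m,q)$ is obtained from disjoint cycles $C_m$ and $C_q$ (with $m$ and $q$ vertices) by identifying a vertex of one with a vertex of the other. For $m,q\ge3$, $p\ge1$, $B(m,p,q)$ is obtained from a path with $p$ edges by identifying one end vertex with a vertex of a cycle $C_m$ and the other end vertex with a vertex of a disjoint cycle $C_q$. -}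

module Defs where

open import Data.Nat using (ℕ; zero; suc; _+_; _∸_; _≤_; _%_)
open import Data.Nat.Properties using ()
open import Data.Fin using (Fin; toℕ)
open import Data.Fin.Subset using (Subset; _∈_; ∣_∣)
open import Data.Product using (_×_; _,_; ∃)
open import Data.Sum using (_⊎_)
open import Data.List using (List; []; _∷_; _++_)
import Data.List.Membership.Propositional as LM
open import Relation.Binary.PropositionalEquality using (_≡_)
open import Relation.Nullary using (¬_)

-- A (simple) graph on the vertex set Fin n, given by an edge list whose
-- endpoints are vertex labels (natural numbers < n).
EdgeList : Set
EdgeList = List (ℕ × ℕ)

Adj : {n : ℕ} → EdgeList → Fin n → Fin n → Set
Adj E i j = LM._∈_ (toℕ i , toℕ j) E ⊎ LM._∈_ (toℕ j , toℕ i) E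

IsIndependent : {n : ℕ} → EdgeList → Subset n → Set
IsIndependent E S = ∀ i j → i ∈ S → j ∈ S → ¬ Adj E i j

IndependenceNumber : (n : ℕ) → EdgeList → ℕ → Set
IndependenceNumber n E k =
  (∃ λ (S : Subset n) → IsIndependent E S × ∣ S ∣ ≡ k)
  × (∀ (S : Subset n) → IsIndependent E S → ∣ S ∣ ≤ k)

-- pathEdges a b o k : edges of a path with k ≥ 1 edges from vertex a to vertex b,
-- whose k-1 internal vertices are o, o+1, ..., o+k-2 (in order).
-- With a = b this is a cycle with k vertices through a.
pathEdges : ℕ → ℕ → ℕ → ℕ → EdgeList
pathEdges a b o zero = []
pathEdges a b o (suc zero) = (a , b) ∷ []
pathEdges a b o (suc (suc k)) = (a , o) ∷ pathEdges o b (suc o) (suc k)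

-- P(m,p,q) on vertices 0..m+p+q-2: the two branch vertices are 0 and 1.
thetaEdges : ℕ → ℕ → ℕ → EdgeList
thetaEdges m p q =
  pathEdges 0 1 2 m ++ pathEdges 0 1 (m + 1) p ++ pathEdges 0 1 (m + p) q

-- C(m,q) on vertices 0..m+q-2: shared vertex 0.
twoCyclesEdges : ℕ → ℕ → EdgeList
twoCyclesEdges m q = pathEdges 0 0 1 m ++ pathEdges 0 0 m q

-- B(m,p,q) on vertices 0..m+p+q-2: vertex 0 on C_m, vertex 1 on C_q,
-- joined by a path with p edges.
dumbbellEdges : ℕ → ℕ → ℕ → EdgeList
dumbbellEdges m p q =
  pathEdges 0 1 2 p ++ pathEdges 0 0 (p + 1) m ++ pathEdges 1 1 (p + m) q

oddness : ℕ → ℕ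
oddness k = k % 2

numOdd3 : ℕ → ℕ → ℕ → ℕ
numOdd3 m p q = oddness m + oddness p + oddness q

-- The three graphs consist of hub vertices joined by internally disjoint paths (ears).
-- If the ends of an ear with L edges carry the selection bits x and y, an independent
-- set contains at most ⌊(L - x - y)/2⌋ of its inner vertices. Summing over the ears,
-- twice the size of an independent set is at most the number of edges, n + 1, minus
-- a loss determined by the selected hubs alone; selecting every other inner vertex
-- of each ear, beginning next to its first end, attains this bound as soon as no ear
-- ends in a selected hub. Hence α = ⌈n/2⌉ - c when every hub selection loses at
-- least 2c and some admissible one at most 2c + 1, and the parity conditions of the
-- theorem are exactly those under which the least loss is at least 2.
{-# OPTIONS --safe #-}
module Submission where

open import Defs
open import Data.Bool using (Bool; true; false; not; _∧_; T)
open import Data.Bool.Properties using (∧-comm; ∧-zeroʳ; ∧-inverseʳ; not-involutive)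
open import Data.Empty using (⊥-elim)
open import Data.Fin using (Fin; toℕ)
import Data.Fin as Fin
open import Data.Fin.Patterns using (0F; 1F)
open import Data.Fin.Subset using (Subset; ∣_∣; _∈_)
open import Data.List as List using (List; []; _∷_)
open import Data.List.Properties using (++-identityʳ)
open import Data.List.Relation.Unary.All as All using (All; []; _∷_)
open import Data.List.Relation.Unary.All.Properties using (++⁺; ++⁻)
import Data.List.Membership.Propositional as List
open import Data.Nat using (ℕ; zero; suc; _+_; _∸_; _≤_; _≥_; _≤ᵇ_; ⌊_/2⌋; ⌈_/2⌉; z≤n; s≤s)
open import Data.Nat.Properties
open import Data.Nat.Tactic.RingSolver using (solve-∀)
open import Data.Product using (_×_; _,_; ∃; proj₁; proj₂)
open import Data.Sum using (inj₁; inj₂)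
open import Data.Unit using (⊤; tt)
open import Data.Vec using (Vec; []; _∷_; _++_; lookup; splitAt)
open import Data.Vec.Properties using ([]=⇒lookup; lookup⇒[]=)
open import Relation.Binary.PropositionalEquality

-- Selection bits and parity

bit : Bool → ℕ
bit true  = 1
bit false = 0

bit≤1 : ∀ b → bit b ≤ 1
bit≤1 true  = ≤-refl
bit≤1 false = z≤n

disjoint-bits : ∀ x y → x ∧ y ≡ false → bit x + bit y ≤ 1
disjoint-bits false y     _  = bit≤1 y
disjoint-bits true  false _  = ≤-refl
disjoint-bits true  true  ()

isOdd : ℕ → Bool
isOdd zero    = false
isOdd (suc n) = not (isOdd n)

parity : ℕ → ℕ
parity n = bit (isOdd n)

parity≤1 : ∀ n → parity n ≤ 1
parity≤1 n = bit≤1 (isOdd n)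

oddness≡parity : ∀ n → oddness n ≡ parity n
oddness≡parity zero          = refl
oddness≡parity (suc zero)    = refl
oddness≡parity (suc (suc n)) =
  trans (oddness≡parity n) (cong bit (sym (not-involutive (isOdd n))))

numOdd3≡parities : ∀ m p q → numOdd3 m p q ≡ parity m + parity p + parity q
numOdd3≡parities m p q =
  cong₂ _+_ (cong₂ _+_ (oddness≡parity m) (oddness≡parity p)) (oddness≡parity q)

isOdd-double : ∀ n → isOdd (n + n) ≡ false
isOdd-double zero    = refl
isOdd-double (suc n) rewrite +-suc n n | isOdd-double n = refl

-- If x + x + t = L, then t + L = (x + t) + (x + t) is even.
+-double-≤-parity : ∀ x t L → x + x + t ≤ L → x + x + (t + parity (t + L)) ≤ L
+-double-≤-parity x t L le with m≤n⇒m<n∨m≡n le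
... | inj₁ lt = begin
  x + x + (t + parity (t + L)) ≡⟨ +-assoc (x + x) t _ ⟨
  x + x + t + parity (t + L)   ≤⟨ +-monoʳ-≤ (x + x + t) (parity≤1 (t + L)) ⟩
  x + x + t + 1                ≡⟨ +-comm _ 1 ⟩
  suc (x + x + t)              ≤⟨ lt ⟩
  L                            ∎
  where open ≤-Reasoning
... | inj₂ refl = ≤-reflexive (cong (x + x +_) (trans (cong (t +_) even) (+-identityʳ t)))
  where
  regroup : ∀ x t → t + (x + x + t) ≡ (x + t) + (x + t)
  regroup = solve-∀
  even : parity (t + (x + x + t)) ≡ 0
  even = cong bit (trans (cong isOdd (regroup x t)) (isOdd-double (x + t)))

+-double-interchange : ∀ c d p q → (c + d) + (c + d) + (p + q) ≡ (c + c + p) + (d + d + q)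
+-double-interchange = solve-∀

⌊/2⌋-between : ∀ a n → a + a ≤ n → n ≤ suc (a + a) → ⌊ n /2⌋ ≡ a
⌊/2⌋-between a n lo hi = ≤-antisym
  (≤-trans (⌊n/2⌋-mono hi) (≤-reflexive (sym (n≡⌈n+n/2⌉ a))))
  (≤-trans (≤-reflexive (n≡⌊n+n/2⌋ a)) (⌊n/2⌋-mono lo))

-- Subsets as selections

∣∷∣ : ∀ {n} b (S : Subset n) → ∣ b ∷ S ∣ ≡ bit b + ∣ S ∣
∣∷∣ true  S = refl
∣∷∣ false S = refl

∣++∣ : ∀ {m n} (S : Subset m) (T : Subset n) → ∣ S ++ T ∣ ≡ ∣ S ∣ + ∣ T ∣
∣++∣ []          T = refl
∣++∣ (true  ∷ S) T = cong suc (∣++∣ S T)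
∣++∣ (false ∷ S) T = ∣++∣ S T

indicator : ∀ {n} → Subset n → ℕ → Bool
indicator []      u       = false
indicator (b ∷ S) zero    = b
indicator (b ∷ S) (suc u) = indicator S u

indicator-lookup : ∀ {n} (S : Subset n) i → indicator S (toℕ i) ≡ lookup S i
indicator-lookup (b ∷ S) Fin.zero    = refl
indicator-lookup (b ∷ S) (Fin.suc i) = indicator-lookup S i

indicator-++ˡ : ∀ {m n} (S : Subset m) (T : Subset n) i → indicator (S ++ T) (toℕ i) ≡ lookup S i
indicator-++ˡ (b ∷ S) T Fin.zero    = refl
indicator-++ˡ (b ∷ S) T (Fin.suc i) = indicator-++ˡ S T i

indicator⇒∈ : ∀ {n} (S : Subset n) u → indicator S u ≡ true → ∃ λ i → toℕ i ≡ u × i ∈ S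
indicator⇒∈ (b ∷ S) zero    b≡true = Fin.zero , refl , lookup⇒[]= Fin.zero (b ∷ S) b≡true
indicator⇒∈ (b ∷ S) (suc u) Su≡true with indicator⇒∈ S u Su≡true
... | i , refl , i∈S = Fin.suc i , refl , lookup⇒[]= (Fin.suc i) (b ∷ S) ([]=⇒lookup i∈S)

Independent : (ℕ → Bool) → EdgeList → Set
Independent f = All (λ (u , v) → f u ∧ f v ≡ false)

isIndependent⇒independent : ∀ {n} E (S : Subset n) → IsIndependent E S → Independent (indicator S) E
isIndependent⇒independent E S ind = All.tabulate (λ {e} → edge e)
  where
  edge : ∀ e → e List.∈ E → indicator S (proj₁ e) ∧ indicator S (proj₂ e) ≡ false
  edge (u , v) uv with indicator S u in Su | indicator S v in Sv
  ... | false | _     = refl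
  ... | true  | false = refl
  ... | true  | true with indicator⇒∈ S u Su | indicator⇒∈ S v Sv
  ...   | i , refl , i∈S | j , refl , j∈S = ⊥-elim (ind i j i∈S j∈S (inj₁ uv))

independent⇒isIndependent : ∀ {n} E (S : Subset n) → Independent (indicator S) E → IsIndependent E S
independent⇒isIndependent E S ind i j i∈S j∈S ij = notBoth (selected i∈S) (selected j∈S) (onEdge ij)
  where
  selected : ∀ {k} → k ∈ S → indicator S (toℕ k) ≡ true
  selected {k} k∈S = trans (indicator-lookup S k) ([]=⇒lookup k∈S)
  onEdge : Adj E i j → indicator S (toℕ i) ∧ indicator S (toℕ j) ≡ false
  onEdge (inj₁ ij) = All.lookup ind ij
  onEdge (inj₂ ji) = trans (∧-comm (indicator S (toℕ i)) _) (All.lookup ind ji)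
  notBoth : ∀ {x y} → x ≡ true → y ≡ true → x ∧ y ≢ false
  notBoth refl refl ()

IsSlice : ∀ {k} → (ℕ → Bool) → ℕ → Vec Bool k → Set
IsSlice f o []       = ⊤
IsSlice f o (b ∷ bs) = f o ≡ b × IsSlice f (suc o) bs

slice-suc : ∀ {k} f o (bs : Vec Bool k) → IsSlice (λ u → f (suc u)) o bs → IsSlice f (suc o) bs
slice-suc f o []       _          = tt
slice-suc f o (b ∷ bs) (fo , fbs) = fo , slice-suc f (suc o) bs fbs

slice-++ : ∀ {k l} f o (bs : Vec Bool k) (cs : Vec Bool l) →
           IsSlice f o (bs ++ cs) → IsSlice f o bs × IsSlice f (o + k) cs
slice-++ f o [] cs sl = tt , subst (λ p → IsSlice f p cs) (sym (+-identityʳ o)) sl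
slice-++ {suc k} f o (b ∷ bs) cs (fo , sl) with slice-++ f (suc o) bs cs sl
... | sbs , scs = (fo , sbs) , subst (λ p → IsSlice f p cs) (sym (+-suc o k)) scs

slice-indicator : ∀ {k} (S : Subset k) → IsSlice (indicator S) 0 S
slice-indicator []      = tt
slice-indicator (b ∷ S) = refl , slice-suc (indicator (b ∷ S)) 0 S (slice-indicator S)

slice-indicator-++ : ∀ {m n} (S : Subset m) (T : Subset n) → IsSlice (indicator (S ++ T)) m T
slice-indicator-++ []      T = slice-indicator T
slice-indicator-++ (b ∷ S) T = slice-suc (indicator (b ∷ S ++ T)) _ T (slice-indicator-++ S T)

-- Paths

path-bound : ∀ {k} f a b o (bs : Vec Bool k) → IsSlice f o bs →
             Independent f (pathEdges a b o (suc k)) →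
             ∣ bs ∣ + ∣ bs ∣ + (bit (f a) + bit (f b)) ≤ suc k
path-bound f a b o [] _ (ab ∷ []) = disjoint-bits (f a) (f b) ab
path-bound {suc k} f a b o (_ ∷ bs) (refl , sl) (ao ∷ rest) = begin
  ∣ f o ∷ bs ∣ + ∣ f o ∷ bs ∣ + (A + B) ≡⟨ cong (λ s → s + s + (A + B)) (∣∷∣ (f o) bs) ⟩
  (O + C) + (O + C) + (A + B)         ≡⟨ regroup O C A B ⟩
  (C + C + (O + B)) + (A + O)         ≤⟨ +-mono-≤ (path-bound f o b (suc o) bs sl rest)
                                                  (disjoint-bits (f a) (f o) ao) ⟩
  suc k + 1                           ≡⟨ +-comm (suc k) 1 ⟩
  suc (suc k)                         ∎
  where
  open ≤-Reasoning
  A = bit (f a)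
  B = bit (f b)
  O = bit (f o)
  C = ∣ bs ∣
  regroup : ∀ O C A B → (O + C) + (O + C) + (A + B) ≡ (C + C + (O + B)) + (A + O)
  regroup = solve-∀

defect : Bool → Bool → ℕ → ℕ
defect x y k = bit x + bit y + parity (bit x + bit y + suc k)

path-bound-defect : ∀ {k} f a b o (bs : Vec Bool k) → IsSlice f o bs →
                    Independent f (pathEdges a b o (suc k)) →
                    ∣ bs ∣ + ∣ bs ∣ + defect (f a) (f b) k ≤ suc k
path-bound-defect f a b o bs sl ind =
  +-double-≤-parity ∣ bs ∣ _ _ (path-bound f a b o bs sl ind)

alternation : Bool → (k : ℕ) → Vec Bool k
alternation b zero    = []
alternation b (suc k) = b ∷ alternation (not b) k

alternation-independent : ∀ f a b o k x → f a ≡ x → f b ≡ false →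
                          IsSlice f o (alternation (not x) k) →
                          Independent f (pathEdges a b o (suc k))
alternation-independent f a b o zero x fa fb _ =
  subst₂ (λ u v → u ∧ v ≡ false) (sym fa) (sym fb) (∧-zeroʳ x) ∷ []
alternation-independent f a b o (suc k) x fa fb (fo , sl) =
  subst₂ (λ u v → u ∧ v ≡ false) (sym fa) (sym fo) (∧-inverseʳ x)
  ∷ alternation-independent f o b (suc o) k (not x) fo fb sl

alternation-tight : ∀ x k →
  ∣ alternation (not x) k ∣ + ∣ alternation (not x) k ∣ + defect x false k ≡ suc k
alternation-tight false zero    = refl
alternation-tight true  zero    = refl
alternation-tight false (suc k) = begin
  suc F + suc F + parity (suc (suc k))     ≡⟨ cong (λ s → suc s + parity (suc (suc k))) (+-suc F F) ⟩
  suc (suc (F + F + parity (suc (suc k)))) ≡⟨ cong suc (+-suc (F + F) _) ⟨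
  suc (F + F + suc (parity (suc (suc k)))) ≡⟨ cong suc (alternation-tight true k) ⟩
  suc (suc k)                              ∎
  where
  open ≡-Reasoning
  F = ∣ alternation false k ∣
alternation-tight true (suc k) = begin
  U + U + suc (parity (suc (suc (suc k))))
    ≡⟨ cong (λ b → U + U + suc (bit b)) (not-involutive (not (isOdd k))) ⟩
  U + U + suc (parity (suc k))             ≡⟨ +-suc (U + U) _ ⟩
  suc (U + U + parity (suc k))             ≡⟨ cong suc (alternation-tight false k) ⟩
  suc (suc k)                              ∎
  where
  open ≡-Reasoning
  U = ∣ alternation true k ∣

-- Ear graphs

-- The hubs of an ear graph are the vertices 0, …, h - 1. An ear is a path with
-- suc (inner e) edges from hub start e to hub end e, and the inner vertices of
-- the ears are numbered consecutively from h on, ear after ear.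
record Ear (h : ℕ) : Set where
  constructor ear
  field
    start end : Fin h
    inner     : ℕ
open Ear

earEdges : ∀ {h} → ℕ → List (Ear h) → EdgeList
earEdges o []               = []
earEdges o (ear a b k ∷ es) = pathEdges (toℕ a) (toℕ b) o (suc k) List.++ earEdges (o + k) es

innerCount : ∀ {h} → List (Ear h) → ℕ
innerCount []       = 0
innerCount (e ∷ es) = inner e + innerCount es

edgeCount : ∀ {h} → List (Ear h) → ℕ
edgeCount []       = 0
edgeCount (e ∷ es) = suc (inner e) + edgeCount es

deficit : ∀ {h} → Vec Bool h → List (Ear h) → ℕ
deficit x []               = 0
deficit x (ear a b k ∷ es) = defect (lookup x a) (lookup x b) k + deficit x es

endLoad : ∀ {h} → Vec Bool h → List (Ear h) → ℕ
endLoad x []               = 0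
endLoad x (ear a b k ∷ es) = bit (lookup x a) + bit (lookup x b) + endLoad x es

endLoad≤deficit : ∀ {h} (x : Vec Bool h) es → endLoad x es ≤ deficit x es
endLoad≤deficit x []               = z≤n
endLoad≤deficit x (ear a b k ∷ es) = +-mono-≤ (m≤m+n _ _) (endLoad≤deficit x es)

≤-deficit-by-load : ∀ {h} (x : Vec Bool h) es {n} → T (n ≤ᵇ endLoad x es) → n ≤ deficit x es
≤-deficit-by-load x es {n} n≤load = ≤-trans (≤ᵇ⇒≤ n _ n≤load) (endLoad≤deficit x es)

ears-bound : ∀ {h} (x : Vec Bool h) f o es (bs : Vec Bool (innerCount es)) →
             (∀ i → f (toℕ i) ≡ lookup x i) → IsSlice f o bs →
             Independent f (earEdges o es) →
             ∣ bs ∣ + ∣ bs ∣ + deficit x es ≤ edgeCount es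
ears-bound x f o [] [] _ _ _ = z≤n
ears-bound x f o (ear a b k ∷ es) bs hubs sl ind with splitAt k bs
... | cs , ds , refl
    with slice-++ f o cs ds sl | ++⁻ (pathEdges (toℕ a) (toℕ b) o (suc k)) ind
...   | scs , sds | onPath , onRest = begin
  ∣ cs ++ ds ∣ + ∣ cs ++ ds ∣ + (defect (lookup x a) (lookup x b) k + deficit x es)
    ≡⟨ cong₂ (λ s d → s + s + (d + deficit x es)) (∣++∣ cs ds)
             (cong₂ (λ u v → defect u v k) (sym (hubs a)) (sym (hubs b))) ⟩
  (C + D) + (C + D) + (defect (f (toℕ a)) (f (toℕ b)) k + deficit x es)
    ≡⟨ +-double-interchange C D _ _ ⟩
  (C + C + defect (f (toℕ a)) (f (toℕ b)) k) + (D + D + deficit x es)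
    ≤⟨ +-mono-≤ (path-bound-defect f (toℕ a) (toℕ b) o cs scs onPath)
                (ears-bound x f (o + k) es ds hubs sds onRest) ⟩
  suc k + edgeCount es ∎
  where
  open ≤-Reasoning
  C = ∣ cs ∣
  D = ∣ ds ∣

fillEars : ∀ {h} → Vec Bool h → (es : List (Ear h)) → Vec Bool (innerCount es)
fillEars x []               = []
fillEars x (ear a b k ∷ es) = alternation (not (lookup x a)) k ++ fillEars x es

EndsUnselected : ∀ {h} → Vec Bool h → List (Ear h) → Set
EndsUnselected x = All (λ e → lookup x (end e) ≡ false)

fillEars-independent : ∀ {h} (x : Vec Bool h) f o es → (∀ i → f (toℕ i) ≡ lookup x i) →
                       EndsUnselected x es → IsSlice f o (fillEars x es) →
                       Independent f (earEdges o es)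
fillEars-independent x f o [] _ _ _ = []
fillEars-independent x f o (ear a b k ∷ es) hubs (b-out ∷ ends) sl
  with slice-++ f o (alternation (not (lookup x a)) k) (fillEars x es) sl
... | onPath , onRest =
  ++⁺ (alternation-independent f (toℕ a) (toℕ b) o k (lookup x a) (hubs a) (trans (hubs b) b-out) onPath)
      (fillEars-independent x f (o + k) es hubs ends onRest)

fillEars-tight : ∀ {h} (x : Vec Bool h) es → EndsUnselected x es →
                 ∣ fillEars x es ∣ + ∣ fillEars x es ∣ + deficit x es ≡ edgeCount es
fillEars-tight x [] [] = refl
fillEars-tight x (ear a b k ∷ es) (b-out ∷ ends) = begin
  ∣ P ++ R ∣ + ∣ P ++ R ∣ + (defect (lookup x a) (lookup x b) k + deficit x es)
    ≡⟨ cong₂ (λ s y → s + s + (defect (lookup x a) y k + deficit x es)) (∣++∣ P R) b-out ⟩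
  (∣ P ∣ + ∣ R ∣) + (∣ P ∣ + ∣ R ∣) + (defect (lookup x a) false k + deficit x es)
    ≡⟨ +-double-interchange ∣ P ∣ ∣ R ∣ _ _ ⟩
  (∣ P ∣ + ∣ P ∣ + defect (lookup x a) false k) + (∣ R ∣ + ∣ R ∣ + deficit x es)
    ≡⟨ cong₂ _+_ (alternation-tight (lookup x a) k) (fillEars-tight x es ends) ⟩
  suc k + edgeCount es ∎
  where
  open ≡-Reasoning
  P = alternation (not (lookup x a)) k
  R = fillEars x es

DeficitAtLeast : ∀ {h} → List (Ear h) → ℕ → Set
DeficitAtLeast es c = ∀ y → (∣ y ∣ + c) + (∣ y ∣ + c) ≤ deficit y es

DeficitAttained : ∀ {h} → List (Ear h) → ℕ → Set
DeficitAttained {h} es c =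
  ∃ λ (x : Vec Bool h) → EndsUnselected x es × deficit x es ≤ suc ((∣ x ∣ + c) + (∣ x ∣ + c))

earGraph-upper : ∀ {h} es c → DeficitAtLeast es c →
  ∀ (S : Subset (h + innerCount es)) → IsIndependent (earEdges h es) S →
  (∣ S ∣ + c) + (∣ S ∣ + c) ≤ edgeCount es
earGraph-upper {h} es c lower S ind with splitAt h S
... | y , bs , refl = begin
  (∣ y ++ bs ∣ + c) + (∣ y ++ bs ∣ + c) ≡⟨ cong (λ s → (s + c) + (s + c)) (∣++∣ y bs) ⟩
  (Y + B + c) + (Y + B + c)             ≡⟨ regroup Y B c ⟩
  ((Y + c) + (Y + c)) + (B + B)         ≤⟨ +-monoˡ-≤ (B + B) (lower y) ⟩
  deficit y es + (B + B)                ≡⟨ +-comm (deficit y es) (B + B) ⟩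
  B + B + deficit y es                  ≤⟨ ears-bound y (indicator (y ++ bs)) h es bs (indicator-++ˡ y bs)
                                             (slice-indicator-++ y bs) (isIndependent⇒independent _ _ ind) ⟩
  edgeCount es ∎
  where
  open ≤-Reasoning
  Y = ∣ y ∣
  B = ∣ bs ∣
  regroup : ∀ Y B c → (Y + B + c) + (Y + B + c) ≡ ((Y + c) + (Y + c)) + (B + B)
  regroup = solve-∀

earGraph-witness : ∀ {h} (x : Vec Bool h) es → EndsUnselected x es →
  IsIndependent (earEdges h es) (x ++ fillEars x es) ×
  ∣ x ++ fillEars x es ∣ + ∣ x ++ fillEars x es ∣ + deficit x es ≡ ∣ x ∣ + ∣ x ∣ + edgeCount es
earGraph-witness {h} x es ends =
    independent⇒isIndependent _ W
      (fillEars-independent x (indicator W) h es (indicator-++ˡ x Z) ends (slice-indicator-++ x Z))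
  , (begin
  ∣ W ∣ + ∣ W ∣ + deficit x es             ≡⟨ cong (λ s → s + s + deficit x es) (∣++∣ x Z) ⟩
  (X + ∣ Z ∣) + (X + ∣ Z ∣) + deficit x es ≡⟨ regroup X ∣ Z ∣ (deficit x es) ⟩
  X + X + (∣ Z ∣ + ∣ Z ∣ + deficit x es)   ≡⟨ cong (X + X +_) (fillEars-tight x es ends) ⟩
  X + X + edgeCount es                     ∎)
  where
  open ≡-Reasoning
  Z = fillEars x es
  W = x ++ Z
  X = ∣ x ∣
  regroup : ∀ X Z d → (X + Z) + (X + Z) + d ≡ X + X + (Z + Z + d)
  regroup = solve-∀

independenceNumber-halving : ∀ {n} E N c (W : Subset n) → IsIndependent E W →
  N ≤ suc ((∣ W ∣ + c) + (∣ W ∣ + c)) →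
  (∀ S → IsIndependent E S → (∣ S ∣ + c) + (∣ S ∣ + c) ≤ N) →
  IndependenceNumber n E (⌊ N /2⌋ ∸ c)
independenceNumber-halving E N c W indW hi upper =
    (W , indW , sym (trans (cong (_∸ c) half) (m+n∸n≡m ∣ W ∣ c)))
  , λ S indS → m+n≤o⇒m≤o∸n ∣ S ∣
      (≤-trans (≤-reflexive (n≡⌊n+n/2⌋ _)) (⌊n/2⌋-mono (upper S indS)))
  where
  half : ⌊ N /2⌋ ≡ ∣ W ∣ + c
  half = ⌊/2⌋-between _ N (upper W indW) hi

earGraph-independenceNumber : ∀ {h} es c → DeficitAtLeast es c → DeficitAttained es c →
  IndependenceNumber (h + innerCount es) (earEdges h es) (⌊ edgeCount es /2⌋ ∸ c)
earGraph-independenceNumber es c lower (x , ends , xDeficit) with earGraph-witness x es ends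
... | indW , tight =
  independenceNumber-halving _ (edgeCount es) c W indW bound (earGraph-upper es c lower)
  where
  open ≤-Reasoning
  W = x ++ fillEars x es
  swap : ∀ w x c → w + w + suc ((x + c) + (x + c)) ≡ x + x + suc ((w + c) + (w + c))
  swap = solve-∀
  bound : edgeCount es ≤ suc ((∣ W ∣ + c) + (∣ W ∣ + c))
  bound = +-cancelˡ-≤ (∣ x ∣ + ∣ x ∣) _ _ (begin
    ∣ x ∣ + ∣ x ∣ + edgeCount es                    ≡⟨ tight ⟨
    ∣ W ∣ + ∣ W ∣ + deficit x es                    ≤⟨ +-monoʳ-≤ (∣ W ∣ + ∣ W ∣) xDeficit ⟩
    ∣ W ∣ + ∣ W ∣ + suc ((∣ x ∣ + c) + (∣ x ∣ + c)) ≡⟨ swap ∣ W ∣ ∣ x ∣ c ⟩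
    ∣ x ∣ + ∣ x ∣ + suc ((∣ W ∣ + c) + (∣ W ∣ + c)) ∎)

IndependenceNumber-resp : ∀ {n n′ E E′ k k′} → n ≡ n′ → E ≡ E′ → k ≡ k′ →
  IndependenceNumber n E k → IndependenceNumber n′ E′ k′
IndependenceNumber-resp refl refl refl α = α

-- The three graphs

second-offset : ∀ m → 2 + m ≡ suc m + 1
second-offset = solve-∀

third-offset : ∀ m p → 2 + m + p ≡ suc m + suc p
third-offset = solve-∀

-- From here on the arguments m, p, q are numbers of inner vertices, that is,
-- path lengths minus one; so isOdd m ≡ false says that the path has odd length.
thetaEars : ℕ → ℕ → ℕ → List (Ear 2)
thetaEars m p q = ear 0F 1F m ∷ ear 0F 1F p ∷ ear 0F 1F q ∷ []

theta-atLeast₀ : ∀ m p q → DeficitAtLeast (thetaEars m p q) 0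
theta-atLeast₀ m p q (false ∷ false ∷ [])   = z≤n
theta-atLeast₀ m p q y@(false ∷ true  ∷ []) = ≤-deficit-by-load y (thetaEars m p q) tt
theta-atLeast₀ m p q y@(true  ∷ false ∷ []) = ≤-deficit-by-load y (thetaEars m p q) tt
theta-atLeast₀ m p q y@(true  ∷ true  ∷ []) = ≤-deficit-by-load y (thetaEars m p q) tt

theta-oneHub-deficit : ∀ m p q → parity (suc m) + parity (suc p) + parity (suc q) ≡ 2 →
  4 ≤ deficit (true ∷ false ∷ []) (thetaEars m p q)
theta-oneHub-deficit m p q two with isOdd m | isOdd p | isOdd q
theta-oneHub-deficit m p q _  | true  | false | false = ≤ᵇ⇒≤ _ _ tt
theta-oneHub-deficit m p q _  | false | true  | false = ≤ᵇ⇒≤ _ _ tt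
theta-oneHub-deficit m p q _  | false | false | true  = ≤ᵇ⇒≤ _ _ tt
theta-oneHub-deficit m p q () | true  | true  | true
theta-oneHub-deficit m p q () | true  | true  | false
theta-oneHub-deficit m p q () | true  | false | true
theta-oneHub-deficit m p q () | false | true  | true
theta-oneHub-deficit m p q () | false | false | false

theta-atLeast₁ : ∀ m p q → parity (suc m) + parity (suc p) + parity (suc q) ≡ 2 →
  DeficitAtLeast (thetaEars m p q) 1
theta-atLeast₁ m p q two (false ∷ false ∷ []) =
  ≤-reflexive (trans (sym two) (regroup (parity (suc m)) (parity (suc p)) (parity (suc q))))
  where
  regroup : ∀ a b c → a + b + c ≡ a + (b + (c + 0))
  regroup = solve-∀
theta-atLeast₁ m p q two (false ∷ true  ∷ []) = theta-oneHub-deficit m p q two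
theta-atLeast₁ m p q two (true  ∷ false ∷ []) = theta-oneHub-deficit m p q two
theta-atLeast₁ m p q two y@(true ∷ true ∷ []) = ≤-deficit-by-load y (thetaEars m p q) tt

theta-attained₁ : ∀ m p q → DeficitAttained (thetaEars m p q) 1
theta-attained₁ m p q = false ∷ false ∷ [] , refl ∷ refl ∷ refl ∷ [] ,
  +-mono-≤ (parity≤1 (suc m)) (+-mono-≤ (parity≤1 (suc p)) (+-mono-≤ (parity≤1 (suc q)) z≤n))

thetaHubs : ℕ → ℕ → ℕ → Vec Bool 2
thetaHubs m p q = (not (isOdd m) ∧ not (isOdd p) ∧ not (isOdd q)) ∷ false ∷ []

-- The hub bit also occurs inside the parities of the deficit, where the
-- with-abstraction cannot see it; hence the rewrites in each case.
thetaHubs-deficit : ∀ m p q → parity (suc m) + parity (suc p) + parity (suc q) ≢ 2 →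
  deficit (thetaHubs m p q) (thetaEars m p q)
    ≤ suc ((∣ thetaHubs m p q ∣ + 0) + (∣ thetaHubs m p q ∣ + 0))
thetaHubs-deficit m p q ≢2 with isOdd m in m-odd | isOdd p in p-odd | isOdd q in q-odd
... | false | false | false rewrite m-odd | p-odd | q-odd = ≤-refl
... | true  | true  | true  rewrite m-odd | p-odd | q-odd = z≤n
... | true  | true  | false rewrite m-odd | p-odd | q-odd = ≤-refl
... | true  | false | true  rewrite m-odd | p-odd | q-odd = ≤-refl
... | false | true  | true  rewrite m-odd | p-odd | q-odd = ≤-refl
... | true  | false | false = ⊥-elim (≢2 refl)
... | false | true  | false = ⊥-elim (≢2 refl)
... | false | false | true  = ⊥-elim (≢2 refl)

theta-attained₀ : ∀ m p q → parity (suc m) + parity (suc p) + parity (suc q) ≢ 2 →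
  DeficitAttained (thetaEars m p q) 0
theta-attained₀ m p q ≢2 = thetaHubs m p q , refl ∷ refl ∷ refl ∷ [] , thetaHubs-deficit m p q ≢2

theta-independenceNumber : ∀ m p q c → DeficitAtLeast (thetaEars m p q) c →
  DeficitAttained (thetaEars m p q) c →
  IndependenceNumber (suc m + suc p + suc q ∸ 1) (thetaEdges (suc m) (suc p) (suc q))
                     (⌈ (suc m + suc p + suc q ∸ 1) /2⌉ ∸ c)
theta-independenceNumber m p q c lower attained =
  IndependenceNumber-resp (vertices m p q) edges (cong (λ N → ⌊ N /2⌋ ∸ c) (edgeCount≡ m p q))
    (earGraph-independenceNumber (thetaEars m p q) c lower attained)
  where
  vertices : ∀ m p q → 2 + (m + (p + (q + 0))) ≡ m + suc p + suc q
  vertices = solve-∀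
  edgeCount≡ : ∀ m p q → suc m + (suc p + (suc q + 0)) ≡ suc (m + suc p + suc q)
  edgeCount≡ = solve-∀
  edges : earEdges 2 (thetaEars m p q) ≡ thetaEdges (suc m) (suc p) (suc q)
  edges = cong₂ (λ o rest → pathEdges 0 1 2 (suc m) List.++ pathEdges 0 1 o (suc p) List.++ rest)
    (second-offset m) (trans (++-identityʳ _) (cong (λ o → pathEdges 0 1 o (suc q)) (third-offset m p)))

α-theta : ∀ (m p q : ℕ) → 1 ≤ m → 1 ≤ p → 1 ≤ q
  → (m ≡ 1 → p ≥ 2 × q ≥ 2) → (p ≡ 1 → m ≥ 2 × q ≥ 2) → (q ≡ 1 → m ≥ 2 × p ≥ 2)
  → (numOdd3 m p q ≡ 2
       → IndependenceNumber (m + p + q ∸ 1) (thetaEdges m p q) (⌈ (m + p + q ∸ 1) /2⌉ ∸ 1))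
  × (numOdd3 m p q ≢ 2
       → IndependenceNumber (m + p + q ∸ 1) (thetaEdges m p q) ⌈ (m + p + q ∸ 1) /2⌉)
α-theta (suc m) (suc p) (suc q) _ _ _ _ _ _ =
    (λ two → theta-independenceNumber m p q 1
               (theta-atLeast₁ m p q (trans (sym odd) two)) (theta-attained₁ m p q))
  , (λ ≢2 → theta-independenceNumber m p q 0
               (theta-atLeast₀ m p q) (theta-attained₀ m p q (λ two → ≢2 (trans odd two))))
  where
  odd = numOdd3≡parities (suc m) (suc p) (suc q)

cyclesEars : ℕ → ℕ → List (Ear 1)
cyclesEars m q = ear 0F 0F m ∷ ear 0F 0F q ∷ []

cycles-atLeast₀ : ∀ m q → DeficitAtLeast (cyclesEars m q) 0
cycles-atLeast₀ m q (false ∷ [])  = z≤n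
cycles-atLeast₀ m q y@(true ∷ []) = ≤-deficit-by-load y (cyclesEars m q) tt

cycles-atLeast₁ : ∀ m q → parity (suc m) + parity (suc q) ≡ 2 → DeficitAtLeast (cyclesEars m q) 1
cycles-atLeast₁ m q two (false ∷ []) =
  ≤-reflexive (trans (sym two) (cong (parity (suc m) +_) (sym (+-identityʳ _))))
cycles-atLeast₁ m q two y@(true ∷ []) = ≤-deficit-by-load y (cyclesEars m q) tt

cycles-attained₁ : ∀ m q → DeficitAttained (cyclesEars m q) 1
cycles-attained₁ m q = false ∷ [] , refl ∷ refl ∷ [] ,
  m≤n⇒m≤1+n (+-mono-≤ (parity≤1 (suc m)) (+-mono-≤ (parity≤1 (suc q)) z≤n))

cycles-noHub-deficit : ∀ m q → parity (suc m) + parity (suc q) ≢ 2 →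
  deficit (false ∷ []) (cyclesEars m q) ≤ 1
cycles-noHub-deficit m q ≢2 with isOdd m | isOdd q
... | true  | true  = z≤n
... | true  | false = ≤-refl
... | false | true  = ≤-refl
... | false | false = ⊥-elim (≢2 refl)

cycles-attained₀ : ∀ m q → parity (suc m) + parity (suc q) ≢ 2 → DeficitAttained (cyclesEars m q) 0
cycles-attained₀ m q ≢2 = false ∷ [] , refl ∷ refl ∷ [] , cycles-noHub-deficit m q ≢2

cycles-independenceNumber : ∀ m q c → DeficitAtLeast (cyclesEars m q) c →
  DeficitAttained (cyclesEars m q) c →
  IndependenceNumber (suc m + suc q ∸ 1) (twoCyclesEdges (suc m) (suc q)) (⌈ (suc m + suc q ∸ 1) /2⌉ ∸ c)
cycles-independenceNumber m q c lower attained =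
  IndependenceNumber-resp (vertices m q)
    (cong (pathEdges 0 0 1 (suc m) List.++_) (++-identityʳ _))
    (cong (λ N → ⌊ N /2⌋ ∸ c) (edgeCount≡ m q))
    (earGraph-independenceNumber (cyclesEars m q) c lower attained)
  where
  vertices : ∀ m q → 1 + (m + (q + 0)) ≡ m + suc q
  vertices = solve-∀
  edgeCount≡ : ∀ m q → suc m + (suc q + 0) ≡ suc (m + suc q)
  edgeCount≡ = solve-∀

α-twoCycles : ∀ (m q : ℕ) → 3 ≤ m → 3 ≤ q
  → (oddness m + oddness q ≡ 2
       → IndependenceNumber (m + q ∸ 1) (twoCyclesEdges m q) (⌈ (m + q ∸ 1) /2⌉ ∸ 1))
  × (oddness m + oddness q ≢ 2
       → IndependenceNumber (m + q ∸ 1) (twoCyclesEdges m q) ⌈ (m + q ∸ 1) /2⌉)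
α-twoCycles (suc m) (suc q) _ _ =
    (λ two → cycles-independenceNumber m q 1
               (cycles-atLeast₁ m q (trans (sym odd) two)) (cycles-attained₁ m q))
  , (λ ≢2 → cycles-independenceNumber m q 0
               (cycles-atLeast₀ m q) (cycles-attained₀ m q (λ two → ≢2 (trans odd two))))
  where
  odd = cong₂ _+_ (oddness≡parity (suc m)) (oddness≡parity (suc q))

dumbbellEars : ℕ → ℕ → ℕ → List (Ear 2)
dumbbellEars m p q = ear 0F 1F p ∷ ear 0F 0F m ∷ ear 1F 1F q ∷ []

dumbbell-atLeast₀ : ∀ m p q → DeficitAtLeast (dumbbellEars m p q) 0
dumbbell-atLeast₀ m p q (false ∷ false ∷ [])   = z≤n
dumbbell-atLeast₀ m p q y@(false ∷ true  ∷ []) = ≤-deficit-by-load y (dumbbellEars m p q) tt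
dumbbell-atLeast₀ m p q y@(true  ∷ false ∷ []) = ≤-deficit-by-load y (dumbbellEars m p q) tt
dumbbell-atLeast₀ m p q y@(true  ∷ true  ∷ []) = ≤-deficit-by-load y (dumbbellEars m p q) tt

dumbbell-oneHub-deficit : ∀ m p q → 2 ≤ parity (suc m) + parity (suc p) + parity (suc q) →
  4 ≤ deficit (true ∷ false ∷ []) (dumbbellEars m p q)
dumbbell-oneHub-deficit m p q ≥2 with isOdd m | isOdd p | isOdd q
dumbbell-oneHub-deficit m p q _        | false | false | false = ≤ᵇ⇒≤ _ _ tt
dumbbell-oneHub-deficit m p q _        | true  | false | false = ≤ᵇ⇒≤ _ _ tt
dumbbell-oneHub-deficit m p q _        | false | true  | false = ≤ᵇ⇒≤ _ _ tt
dumbbell-oneHub-deficit m p q _        | false | false | true  = ≤ᵇ⇒≤ _ _ tt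
dumbbell-oneHub-deficit m p q ()       | true  | true  | true
dumbbell-oneHub-deficit m p q (s≤s ()) | true  | true  | false
dumbbell-oneHub-deficit m p q (s≤s ()) | true  | false | true
dumbbell-oneHub-deficit m p q (s≤s ()) | false | true  | true

dumbbell-atLeast₁ : ∀ m p q → 2 ≤ parity (suc m) + parity (suc p) + parity (suc q) →
  DeficitAtLeast (dumbbellEars m p q) 1
dumbbell-atLeast₁ m p q ≥2 (false ∷ false ∷ []) =
  ≤-trans ≥2 (≤-reflexive (regroup (parity (suc m)) (parity (suc p)) (parity (suc q))))
  where
  regroup : ∀ a b c → a + b + c ≡ b + (a + (c + 0))
  regroup = solve-∀
dumbbell-atLeast₁ m p q ≥2 (true ∷ false ∷ []) = dumbbell-oneHub-deficit m p q ≥2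
-- Selecting only the second hub is the mirror image of selecting only the first.
dumbbell-atLeast₁ m p q ≥2 (false ∷ true ∷ []) = begin
  4                                                ≤⟨ dumbbell-oneHub-deficit q p m
                                                        (≤-trans ≥2 (≤-reflexive (swap M P Q))) ⟩
  deficit (true ∷ false ∷ []) (dumbbellEars q p m) ≡⟨ mirror (parity (suc (suc p)))
                                                        (parity (suc (suc (suc q)))) M ⟩
  deficit (false ∷ true ∷ []) (dumbbellEars m p q) ∎
  where
  open ≤-Reasoning
  M = parity (suc m)
  P = parity (suc p)
  Q = parity (suc q)
  swap : ∀ m p q → m + p + q ≡ q + p + m
  swap = solve-∀
  mirror : ∀ a b c → (1 + a) + ((2 + b) + (c + 0)) ≡ (1 + a) + (c + ((2 + b) + 0))
  mirror = solve-∀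
dumbbell-atLeast₁ m p q ≥2 y@(true ∷ true ∷ []) = ≤-deficit-by-load y (dumbbellEars m p q) tt

dumbbell-attained₁ : ∀ m p q → DeficitAttained (dumbbellEars m p q) 1
dumbbell-attained₁ m p q = false ∷ false ∷ [] , refl ∷ refl ∷ refl ∷ [] ,
  +-mono-≤ (parity≤1 (suc p)) (+-mono-≤ (parity≤1 (suc m)) (+-mono-≤ (parity≤1 (suc q)) z≤n))

dumbbell-attained₀ : ∀ m p q → parity (suc m) + parity (suc p) + parity (suc q) ≤ 1 →
  DeficitAttained (dumbbellEars m p q) 0
dumbbell-attained₀ m p q ≤1 = false ∷ false ∷ [] , refl ∷ refl ∷ refl ∷ [] ,
  ≤-trans (≤-reflexive (regroup (parity (suc m)) (parity (suc p)) (parity (suc q)))) ≤1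
  where
  regroup : ∀ a b c → b + (a + (c + 0)) ≡ a + b + c
  regroup = solve-∀

dumbbell-independenceNumber : ∀ m p q c → DeficitAtLeast (dumbbellEars m p q) c →
  DeficitAttained (dumbbellEars m p q) c →
  IndependenceNumber (suc m + suc p + suc q ∸ 1) (dumbbellEdges (suc m) (suc p) (suc q))
                     (⌈ (suc m + suc p + suc q ∸ 1) /2⌉ ∸ c)
dumbbell-independenceNumber m p q c lower attained =
  IndependenceNumber-resp (vertices m p q) edges (cong (λ N → ⌊ N /2⌋ ∸ c) (edgeCount≡ m p q))
    (earGraph-independenceNumber (dumbbellEars m p q) c lower attained)
  where
  vertices : ∀ m p q → 2 + (p + (m + (q + 0))) ≡ m + suc p + suc q
  vertices = solve-∀
  edgeCount≡ : ∀ m p q → suc p + (suc m + (suc q + 0)) ≡ suc (m + suc p + suc q)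
  edgeCount≡ = solve-∀
  edges : earEdges 2 (dumbbellEars m p q) ≡ dumbbellEdges (suc m) (suc p) (suc q)
  edges = cong₂ (λ o rest → pathEdges 0 1 2 (suc p) List.++ pathEdges 0 0 o (suc m) List.++ rest)
    (second-offset p) (trans (++-identityʳ _) (cong (λ o → pathEdges 1 1 o (suc q)) (third-offset p m)))

α-dumbbell : ∀ (m p q : ℕ) → 3 ≤ m → 1 ≤ p → 3 ≤ q
  → (numOdd3 m p q ≥ 2
       → IndependenceNumber (m + p + q ∸ 1) (dumbbellEdges m p q) (⌈ (m + p + q ∸ 1) /2⌉ ∸ 1))
  × (numOdd3 m p q ≤ 1
       → IndependenceNumber (m + p + q ∸ 1) (dumbbellEdges m p q) ⌈ (m + p + q ∸ 1) /2⌉)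
α-dumbbell (suc m) (suc p) (suc q) _ _ _ =
    (λ ≥2 → dumbbell-independenceNumber m p q 1
              (dumbbell-atLeast₁ m p q (≤-trans ≥2 (≤-reflexive odd))) (dumbbell-attained₁ m p q))
  , (λ ≤1 → dumbbell-independenceNumber m p q 0
              (dumbbell-atLeast₀ m p q) (dumbbell-attained₀ m p q (≤-trans (≤-reflexive (sym odd)) ≤1)))
  where
  odd = numOdd3≡parities (suc m) (suc p) (suc q)

lemma4p3 :
    (∀ (m p q : ℕ) → 1 ≤ m → 1 ≤ p → 1 ≤ q
       → (m ≡ 1 → p ≥ 2 × q ≥ 2) → (p ≡ 1 → m ≥ 2 × q ≥ 2) → (q ≡ 1 → m ≥ 2 × p ≥ 2)
       → (numOdd3 m p q ≡ 2
            → IndependenceNumber (m + p + q ∸ 1) (thetaEdges m p q) (⌈ (m + p + q ∸ 1) /2⌉ ∸ 1))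
       × (numOdd3 m p q ≢ 2
            → IndependenceNumber (m + p + q ∸ 1) (thetaEdges m p q) ⌈ (m + p + q ∸ 1) /2⌉))
    × (∀ (m q : ℕ) → 3 ≤ m → 3 ≤ q
       → (oddness m + oddness q ≡ 2
            → IndependenceNumber (m + q ∸ 1) (twoCyclesEdges m q) (⌈ (m + q ∸ 1) /2⌉ ∸ 1))
       × (oddness m + oddness q ≢ 2
            → IndependenceNumber (m + q ∸ 1) (twoCyclesEdges m q) ⌈ (m + q ∸ 1) /2⌉))
    × (∀ (m p q : ℕ) → 3 ≤ m → 1 ≤ p → 3 ≤ q
       → (numOdd3 m p q ≥ 2
            → IndependenceNumber (m + p + q ∸ 1) (dumbbellEdges m p q) (⌈ (m + p + q ∸ 1) /2⌉ ∸ 1))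
       × (numOdd3 m p q ≤ 1
            → IndependenceNumber (m + p + q ∸ 1) (dumbbellEdges m p q) ⌈ (m + p + q ∸ 1) /2⌉))
lemma4p3 = α-theta , α-twoCycles , α-dumbbell
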